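{- Let $s, c$ be positive integers with $c \le s$. Every configuration in $\mathcal{B}_{\textsc{ind}}(s,c,\mathbb{N}_+)$ with all parking spots initially empty is solvable.
   Context: Bus Out model. Fix a set of colors. A passenger queue is a finite sequence of colors. A parking spot is either empty, denoted $\varepsilon$, or occupied by a bus, written $(x,k)$ with $x$ a color and $k \ge 1$ the number of remaining seats. A spot occupancy state with $s$ spots is an $s$-tuple of spot states. A congestion graph is a finite directed graph whose vertices (buses) are labeled by (color, capacity) with capacity a positive integer; an edge $u\to v$ means bus $v$ blocks bus $u$. A vertex is free if its out-degree is $0$. A configuration is a triple $(G,Q,S)$; it is empty if $G$ and $Q$ are empty and all spots are $\varepsilon$. $(G,Q,S)$ can transition to $(G',Q',S')$ if either (1) $Q'=Q$, $G'$ is $G$ with a free vertex labeled $(x,k)$ removed, and $S'$ is $S$ with one entry $\varepsilon$ replaced by $(x,k)$; or (2) $G'=G$, $Q'$ is $Q$ with its first element $x$ removed, and $S'$ is $S$ with an entry $(x,k+1)$ replaced by $(x,k)$ for some $k\ge1$, or an entry $(x,1)$ replaced by $\varepsilon$. Whenever a type (2) transition is applicable, it is performed before any type (1) transition may be chosen. A configuration is solvable if some sequence of transitions leads to the empty configuration. A configuration is eligible if $G$ is acyclic and, for each color, the total capacity of buses of that color equals the number of passengers of that color. $\mathcal{B}(s,c,V)$ is the class of eligible configurations with exactly $s$ parking spots, at most $c$ colors, and bus capacities in $V$; $\mathcal{B}_{\textsc{ind}}(s,c,V)$ consists of those whose congestion graph has no edges. -}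

module Defs where

open import Data.Nat using (ℕ; zero; suc; _+_; _≤_)
open import Data.Fin using (Fin)
open import Data.Fin.Properties using (_≟_)
open import Data.List using (List; []; _∷_; _++_; map; filter; length)
open import Data.Nat.ListAction using (sum)
open import Data.Vec using (Vec; replicate; lookup; _[_]≔_)
open import Data.Product using (Σ; ∃; _×_; _,_)
open import Relation.Nullary using (¬_)
open import Relation.Binary.PropositionalEquality using (_≡_)
open import Relation.Binary.Construct.Closure.ReflexiveTransitive using (Star)

-- Colours: a configuration with at most c colours uses colours from Fin c.

record Bus (c : ℕ) : Set where
  constructor bus
  field
    colour : Fin c
    cap    : ℕ
open Bus public

-- A parking spot: empty (ε) or occupied by a bus (x,k) with k remaining seats.
data Spot (c : ℕ) : Set where
  ε   : Spot c
  occ : Fin c → ℕ → Spot c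

-- Configuration with an EDGELESS congestion graph (class B_ind):
-- the graph is just a finite multiset of labelled vertices, given as a list.
record Config (c s : ℕ) : Set where
  constructor ⟨_,_,_⟩
  field
    graph : List (Bus c)
    queue : List (Fin c)
    spots : Vec (Spot c) s
open Config public

data Step₂ {c s : ℕ} : Config c s → Config c s → Set where
  board : ∀ {G Q S} (x : Fin c) (i : Fin s) (k : ℕ) →
          lookup S i ≡ occ x (suc (suc k)) →
          Step₂ ⟨ G , x ∷ Q , S ⟩ ⟨ G , Q , S [ i ]≔ occ x (suc k) ⟩
  board-last : ∀ {G Q S} (x : Fin c) (i : Fin s) →
          lookup S i ≡ occ x 1 →
          Step₂ ⟨ G , x ∷ Q , S ⟩ ⟨ G , Q , S [ i ]≔ ε ⟩

Can₂ : ∀ {c s} → Config c s → Set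
Can₂ C = ∃ λ C' → Step₂ C C'

-- Transitions; type (1) (a free vertex -- in an edgeless graph every vertex
-- is free -- parks in an empty spot) only when no type (2) is applicable.
data Step {c s : ℕ} : Config c s → Config c s → Set where
  step₂ : ∀ {C C'} → Step₂ C C' → Step C C'
  step₁ : ∀ {G₁ G₂ Q S} (b : Bus c) (i : Fin s) →
          ¬ Can₂ ⟨ G₁ ++ b ∷ G₂ , Q , S ⟩ →
          lookup S i ≡ ε →
          Step ⟨ G₁ ++ b ∷ G₂ , Q , S ⟩
               ⟨ G₁ ++ G₂ , Q , S [ i ]≔ occ (colour b) (cap b) ⟩

emptyConfig : ∀ {c s} → Config c s
emptyConfig {s = s} = ⟨ [] , [] , replicate s ε ⟩

Solvable : ∀ {c s} → Config c s → Set
Solvable C = Star Step C emptyConfig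

count : ∀ {c} → Fin c → List (Fin c) → ℕ
count x Q = length (filter (x ≟_) Q)

capOf : ∀ {c} → Fin c → List (Bus c) → ℕ
capOf x G = sum (map cap (filter (λ b → x ≟ colour b) G))

-- Eligibility (the edgeless graph is trivially acyclic): capacities balance.
Eligible : ∀ {c s} → Config c s → Set
Eligible {c} C = ∀ (x : Fin c) → capOf x (graph C) ≡ count x (queue C)

{-# OPTIONS --safe #-}
module Submission where

-- Serve the queue greedily. If a bus of the first passenger's colour is parked,
-- the passenger boards it. Otherwise a bus of that colour is still waiting, since
-- capacities balance, and some spot is empty, since the parked buses have pairwise
-- distinct colours all different from the passenger's while c ≤ s; that bus parks
-- there and the passenger boards. The invariant carried along: parked buses have
-- pairwise distinct colours and at least one free seat, and for every colour the
-- waiting capacity plus the free parked seats equals the number of queued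
-- passengers of that colour. Once the queue is empty it forces the empty configuration.

open import Defs
open import Data.Nat using (ℕ; zero; suc; _+_; _≤_; _<_; z≤n; s≤s; _<?_)
open import Data.Nat.Properties
  using (+-assoc; +-comm; +-suc; +-identityʳ; +-cancelʳ-≡; m+n≡0⇒m≡0; m+n≡0⇒n≡0;
         n≮0; n≤1+n; ≤-trans; ≤⇒≯; ≮⇒≥; n≤0⇒n≡0; +-commutativeSemigroup)
open import Algebra.Properties.CommutativeSemigroup +-commutativeSemigroup
  using (x∙yz≈y∙xz; x∙yz≈zx∙y; xy∙z≈zy∙x)
open import Data.Fin using (Fin; zero; suc)
open import Data.Fin.Properties using (_≟_; any?; punchOut-injective; injective⇒≤)
open import Data.List using (List; []; _∷_; _++_)
open import Data.List.Relation.Unary.All using (All; []; _∷_)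
open import Data.List.Relation.Unary.All.Properties using (++⁺; ++⁻)
open import Data.Vec using (Vec; []; _∷_; lookup; _[_]≔_; replicate; map; sum)
open import Data.Vec.Properties
  using (lookup∘update; lookup∘update′; lookup-map; map-[]≔; lookup-replicate)
open import Data.Product using (∃; ∃₂; _×_; _,_; proj₁; proj₂)
open import Data.Sum using (_⊎_; inj₁; inj₂)
open import Data.Unit using (⊤; tt)
open import Data.Empty using (⊥-elim)
open import Function using (_∘_)
open import Function.Definitions using (Injective)
open import Relation.Nullary using (¬_; Dec; yes; no; contradiction)
open import Relation.Binary.PropositionalEquality
  using (_≡_; _≢_; refl; sym; trans; cong; cong₂; subst; module ≡-Reasoning)
open import Relation.Binary.Construct.Closure.ReflexiveTransitive
  using (Star; _◅_; _◅◅_) renaming (ε to done)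

open ≡-Reasoning

private variable
  A : Set
  c n k m : ℕ
  x y : Fin c
  w v : Spot c
  b : Bus c
  G G₁ G₂ : List (Bus c)
  Q : List (Fin c)
  S : Vec (Spot c) n
  i : Fin n

sum-[]≔ : ∀ (xs : Vec ℕ n) i m → sum (xs [ i ]≔ m) + lookup xs i ≡ sum xs + m
sum-[]≔ (l ∷ xs) zero    m = xy∙z≈zy∙x m (sum xs) l
sum-[]≔ (l ∷ xs) (suc i) m = begin
  l + sum (xs [ i ]≔ m) + lookup xs i    ≡⟨ +-assoc l _ _ ⟩
  l + (sum (xs [ i ]≔ m) + lookup xs i)  ≡⟨ cong (l +_) (sum-[]≔ xs i m) ⟩
  l + (sum xs + m)                       ≡⟨ +-assoc l _ _ ⟨
  l + sum xs + m                         ∎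

lookup-[]≔⁺ : ∀ (P : A → Set) (xs : Vec A n) i {a} → P a → (∀ j → P (lookup xs j)) →
              ∀ j → P (lookup (xs [ i ]≔ a) j)
lookup-[]≔⁺ P xs i {a} pa pxs j with j ≟ i
... | yes refl = subst P (sym (lookup∘update j xs a)) pa
... | no  j≢i  = subst P (sym (lookup∘update′ j≢i xs a)) (pxs j)

lookup-[]≔⁻ : ∀ (P : A → Set) (xs : Vec A n) i {a} j → P (lookup (xs [ i ]≔ a) j) →
              (j ≡ i × P a) ⊎ P (lookup xs j)
lookup-[]≔⁻ P xs i {a} j p with j ≟ i
... | yes refl = inj₁ (refl , subst P (lookup∘update j xs a) p)
... | no  j≢i  = inj₂ (subst P (lookup∘update′ j≢i xs a) p)

All-++-∷⁻ : ∀ {P : A → Set} xs {a ys} → All P (xs ++ a ∷ ys) → P a × All P (xs ++ ys)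
All-++-∷⁻ xs pxs with ++⁻ xs pxs
... | pxs₁ , pa ∷ pys = pa , ++⁺ pxs₁ pys

injective-missing⇒< : ∀ {f : Fin n → Fin c} (x : Fin c) →
                      Injective _≡_ _≡_ f → (∀ i → x ≢ f i) → n < c
injective-missing⇒< {c = suc _} x f-inj x∉f =
  s≤s (injective⇒≤ (f-inj ∘ punchOut-injective (x∉f _) (x∉f _)))

seat : Fin c → Spot c → ℕ
seat y ε = 0
seat y (occ x k) with y ≟ x
... | yes _ = k
... | no  _ = 0

seats : Fin c → Vec (Spot c) n → ℕ
seats y S = sum (map (seat y) S)

Parked : Fin c → Vec (Spot c) n → Set
Parked x S = ∃ λ i → 0 < seat x (lookup S i)

parked? : ∀ (x : Fin c) (S : Vec (Spot c) n) → Dec (Parked x S)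
parked? x S = any? (λ i → 0 <? seat x (lookup S i))

occ-seated : 0 < k → 0 < seat x (occ x k)
occ-seated {x = x} k>0 with x ≟ x
... | yes _   = k>0
... | no  x≢x = contradiction refl x≢x

occ-seats≢0 : ∀ (x : Fin c) → 0 < k → seat x (occ x k) + m ≢ 0
occ-seats≢0 {k = k} x k>0 e =
  n≮0 (subst (0 <_) (m+n≡0⇒m≡0 (seat x (occ x k)) e) (occ-seated k>0))

seated-colour : 0 < seat y (occ x k) → y ≡ x
seated-colour {y = y} {x = x} p with y ≟ x
... | yes y≡x = y≡x
seated-colour () | no _

seated-occupant : ∀ (w : Spot c) → 0 < seat x w → ∃ λ k → w ≡ occ x (suc k)
seated-occupant {x = x} (occ y k) p with x ≟ y
seated-occupant (occ _ (suc k)) p | yes refl = k , refl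
seated-occupant ε ()

seats-[]≔ : ∀ (S : Vec (Spot c) n) → lookup S i ≡ w →
            seats y (S [ i ]≔ v) + seat y w ≡ seats y S + seat y v
seats-[]≔ {i = i} {y = y} {v = v} S refl = begin
  sum (map (seat y) (S [ i ]≔ v)) + seat y (lookup S i)
    ≡⟨ cong₂ _+_ (cong sum (map-[]≔ (seat y) S i)) (sym (lookup-map i (seat y) S)) ⟩
  sum (map (seat y) S [ i ]≔ seat y v) + lookup (map (seat y) S) i
    ≡⟨ sum-[]≔ (map (seat y) S) i (seat y v) ⟩
  seats y S + seat y v
    ∎

seats-replicate-ε : ∀ n → seats y (replicate n ε) ≡ 0
seats-replicate-ε zero    = refl
seats-replicate-ε (suc n) = seats-replicate-ε n

unparked⇒seats≡0 : ∀ (S : Vec (Spot c) n) → ¬ Parked x S → seats x S ≡ 0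
unparked⇒seats≡0 []      _  = refl
unparked⇒seats≡0 (w ∷ S) ¬p =
  cong₂ _+_ (n≤0⇒n≡0 (≮⇒≥ λ p → ¬p (zero , p)))
            (unparked⇒seats≡0 S λ (i , p) → ¬p (suc i , p))

afterBoarding : Fin c → ℕ → Spot c
afterBoarding x zero    = ε
afterBoarding x (suc k) = occ x (suc k)

boarding : ∀ (S : Vec (Spot c) n) → lookup S i ≡ occ x (suc k) →
           Step₂ ⟨ G , x ∷ Q , S ⟩ ⟨ G , Q , S [ i ]≔ afterBoarding x k ⟩
boarding {i = i} {x = x} {k = zero}  S e = board-last x i e
boarding {i = i} {x = x} {k = suc k} S e = board x i k e

afterBoarding-seat≤ : ∀ k → seat y (afterBoarding x k) ≤ seat y (occ x (suc k))
afterBoarding-seat≤ zero = z≤n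
afterBoarding-seat≤ {y = y} {x = x} (suc k) with y ≟ x
... | yes _ = n≤1+n (suc k)
... | no  _ = z≤n

boarding-conserves : ∀ k → seat y (occ x (suc k)) + count y Q ≡
                           seat y (afterBoarding x k) + count y (x ∷ Q)
boarding-conserves {y = y} {x = x} zero with y ≟ x
... | yes _ = refl
... | no  _ = refl
boarding-conserves {y = y} {x = x} {Q = Q} (suc k) with y ≟ x
... | yes _ = sym (+-suc (suc k) (count y Q))
... | no  _ = refl

cannot-board : ¬ Parked x S → ¬ Can₂ ⟨ G , x ∷ Q , S ⟩
cannot-board {x = x} ¬p (_ , board _ i k e) =
  ¬p (i , subst (λ w → 0 < seat x w) (sym e) (occ-seated (s≤s z≤n)))
cannot-board {x = x} ¬p (_ , board-last _ i e) =
  ¬p (i , subst (λ w → 0 < seat x w) (sym e) (occ-seated (s≤s z≤n)))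

capOf-extract : ∀ (y : Fin c) G₁ b G₂ →
                capOf y (G₁ ++ b ∷ G₂) ≡ seat y (occ (colour b) (cap b)) + capOf y (G₁ ++ G₂)
capOf-extract y [] b G₂ with y ≟ colour b
... | yes _ = refl
... | no  _ = refl
capOf-extract y (a ∷ G₁) b G₂ with y ≟ colour a
... | yes _ = begin
  cap a + capOf y (G₁ ++ b ∷ G₂)       ≡⟨ cong (cap a +_) (capOf-extract y G₁ b G₂) ⟩
  cap a + (parked + capOf y (G₁ ++ G₂)) ≡⟨ x∙yz≈y∙xz (cap a) parked (capOf y (G₁ ++ G₂)) ⟩
  parked + (cap a + capOf y (G₁ ++ G₂)) ∎
  where
  parked : ℕ
  parked = seat y (occ (colour b) (cap b))
... | no  _ = capOf-extract y G₁ b G₂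

capOf-positive⇒split : 0 < capOf x G → ∃₂ λ G₁ G₂ → ∃ λ b → G ≡ G₁ ++ b ∷ G₂ × colour b ≡ x
capOf-positive⇒split {x = x} {G = a ∷ G} p with x ≟ colour a
... | yes x≡a = [] , G , a , refl , sym x≡a
... | no  _ with capOf-positive⇒split {G = G} p
...   | G₁ , G₂ , b , refl , b≡x = a ∷ G₁ , G₂ , b , refl , b≡x

count-head : ∀ (x : Fin c) Q → count x (x ∷ Q) ≡ suc (count x Q)
count-head x Q with x ≟ x
... | yes _   = refl
... | no  x≢x = contradiction refl x≢x

-- The paper requires k ≥ 1 for an occupied spot (x,k); the type Spot does not.
WellFormed : Spot c → Set
WellFormed ε         = ⊤
WellFormed (occ _ k) = 0 < k

afterBoarding-wellFormed : ∀ k → WellFormed (afterBoarding x k)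
afterBoarding-wellFormed zero    = tt
afterBoarding-wellFormed (suc k) = s≤s z≤n

OneSpotPerColour : Vec (Spot c) n → Set
OneSpotPerColour {c = c} S =
  ∀ (y : Fin c) i j → 0 < seat y (lookup S i) → 0 < seat y (lookup S j) → i ≡ j

oneSpotPerColour-[]≔ : ∀ {S : Vec (Spot c) n} → OneSpotPerColour S →
  (∀ y j → 0 < seat y v → 0 < seat y (lookup S j) → j ≡ i) →
  OneSpotPerColour (S [ i ]≔ v)
oneSpotPerColour-[]≔ {S = S} one fresh y j₁ j₂ p₁ p₂
  with lookup-[]≔⁻ (λ w → 0 < seat y w) S _ j₁ p₁
     | lookup-[]≔⁻ (λ w → 0 < seat y w) S _ j₂ p₂
... | inj₁ (refl , _)  | inj₁ (refl , _)  = refl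
... | inj₁ (refl , q₁) | inj₂ q₂          = sym (fresh y j₂ q₁ q₂)
... | inj₂ q₁          | inj₁ (refl , q₂) = fresh y j₁ q₂ q₁
... | inj₂ q₁          | inj₂ q₂          = one y j₁ j₂ q₁ q₂

occupantOr : Fin c → Spot c → Fin c
occupantOr x ε         = x
occupantOr _ (occ y _) = y

occupant-seated : WellFormed w → w ≢ ε → 0 < seat (occupantOr x w) w
occupant-seated {w = ε}       _  w≢ε = contradiction refl w≢ε
occupant-seated {w = occ _ _} wf _   = occ-seated wf

empty? : (w : Spot c) → Dec (w ≡ ε)
empty? ε         = yes refl
empty? (occ _ _) = no λ ()

emptySpot : ∀ {x : Fin c} {S : Vec (Spot c) n} → c ≤ n →
            (∀ i → WellFormed (lookup S i)) → OneSpotPerColour S → ¬ Parked x S →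
            ∃ λ i → lookup S i ≡ ε
emptySpot {c = c} {n = n} {x = x} {S = S} c≤n wf one ¬p
  with any? (λ i → empty? (lookup S i))
... | yes found = found
... | no  full  = contradiction (injective-missing⇒< x colour-injective x-missing) (≤⇒≯ c≤n)
  where
  colourAt : Fin n → Fin c
  colourAt i = occupantOr x (lookup S i)
  seated : ∀ i → 0 < seat (colourAt i) (lookup S i)
  seated i = occupant-seated (wf i) (λ e → full (i , e))
  colour-injective : Injective _≡_ _≡_ colourAt
  colour-injective {i} {j} e =
    one (colourAt i) i j (seated i) (subst (λ y → 0 < seat y (lookup S j)) (sym e) (seated j))
  x-missing : ∀ i → x ≢ colourAt i
  x-missing i e = ¬p (i , subst (λ y → 0 < seat y (lookup S i)) (sym e) (seated i))

record Invariant (G : List (Bus c)) (Q : List (Fin c)) (S : Vec (Spot c) n) : Set where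
  field
    caps-positive    : All (λ b → 0 < cap b) G
    spots-wellFormed : ∀ i → WellFormed (lookup S i)
    oneSpotPerColour : OneSpotPerColour S
    balanced         : ∀ y → capOf y G + seats y S ≡ count y Q

board-invariant : ∀ {S : Vec (Spot c) n} → Invariant G (x ∷ Q) S →
                  lookup S i ≡ occ x (suc k) → Invariant G Q (S [ i ]≔ afterBoarding x k)
board-invariant {c = c} {n = n} {G = G} {x = x} {Q = Q} {i = i} {k = k} {S = S} inv e = record
  { caps-positive    = caps-positive
  ; spots-wellFormed = lookup-[]≔⁺ WellFormed S i (afterBoarding-wellFormed k) spots-wellFormed
  ; oneSpotPerColour = oneSpotPerColour-[]≔ {S = S} oneSpotPerColour fresh
  ; balanced         = balanced′
  }
  where
  open Invariant inv
  fresh : ∀ y j → 0 < seat y (afterBoarding x k) → 0 < seat y (lookup S j) → j ≡ i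
  fresh y j p q = oneSpotPerColour y j i q
    (≤-trans p (subst (seat y (afterBoarding x k) ≤_) (cong (seat y) (sym e))
                      (afterBoarding-seat≤ k)))
  balanced′ : ∀ y → capOf y G + seats y (S [ i ]≔ afterBoarding x k) ≡ count y Q
  balanced′ y = +-cancelʳ-≡ before _ _ (begin
    capOf y G + seats y S′ + before    ≡⟨ +-assoc (capOf y G) _ _ ⟩
    capOf y G + (seats y S′ + before)  ≡⟨ cong (capOf y G +_) (seats-[]≔ S e) ⟩
    capOf y G + (seats y S + after)    ≡⟨ +-assoc (capOf y G) _ _ ⟨
    capOf y G + seats y S + after      ≡⟨ cong (_+ after) (balanced y) ⟩
    count y (x ∷ Q) + after            ≡⟨ +-comm _ after ⟩
    after + count y (x ∷ Q)            ≡⟨ boarding-conserves k ⟨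
    before + count y Q                 ≡⟨ +-comm before _ ⟩
    count y Q + before                 ∎)
    where
    S′ : Vec (Spot c) n
    S′ = S [ i ]≔ afterBoarding x k
    before after : ℕ
    before = seat y (occ x (suc k))
    after  = seat y (afterBoarding x k)

park-invariant : ∀ {S : Vec (Spot c) n} → Invariant (G₁ ++ b ∷ G₂) Q S →
                 ¬ Parked (colour b) S → lookup S i ≡ ε →
                 Invariant (G₁ ++ G₂) Q (S [ i ]≔ occ (colour b) (cap b))
park-invariant {c = c} {n = n} {G₁ = G₁} {b = b} {G₂ = G₂} {Q = Q} {i = i} {S = S} inv ¬p e = record
  { caps-positive    = proj₂ (All-++-∷⁻ G₁ caps-positive)
  ; spots-wellFormed = lookup-[]≔⁺ WellFormed S i (proj₁ (All-++-∷⁻ G₁ caps-positive))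
                                  spots-wellFormed
  ; oneSpotPerColour = oneSpotPerColour-[]≔ {S = S} oneSpotPerColour fresh
  ; balanced         = balanced′
  }
  where
  open Invariant inv
  fresh : ∀ y j → 0 < seat y (occ (colour b) (cap b)) → 0 < seat y (lookup S j) → j ≡ i
  fresh y j p q = ⊥-elim (¬p (j , subst (λ z → 0 < seat z (lookup S j)) (seated-colour p) q))
  balanced′ : ∀ y → capOf y (G₁ ++ G₂) + seats y (S [ i ]≔ occ (colour b) (cap b)) ≡ count y Q
  balanced′ y = begin
    capOf y (G₁ ++ G₂) + seats y S′           ≡⟨ cong (capOf y (G₁ ++ G₂) +_) (+-identityʳ _) ⟨
    capOf y (G₁ ++ G₂) + (seats y S′ + 0)     ≡⟨ cong (capOf y (G₁ ++ G₂) +_) (seats-[]≔ S e) ⟩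
    capOf y (G₁ ++ G₂) + (seats y S + parked) ≡⟨ x∙yz≈zx∙y (capOf y (G₁ ++ G₂)) (seats y S) parked ⟩
    parked + capOf y (G₁ ++ G₂) + seats y S   ≡⟨ cong (_+ seats y S) (capOf-extract y G₁ b G₂) ⟨
    capOf y (G₁ ++ b ∷ G₂) + seats y S        ≡⟨ balanced y ⟩
    count y Q                                 ∎
    where
    S′ : Vec (Spot c) n
    S′ = S [ i ]≔ occ (colour b) (cap b)
    parked : ℕ
    parked = seat y (occ (colour b) (cap b))

noCapacity⇒[] : All (λ b → 0 < cap b) G → (∀ y → capOf y G ≡ 0) → G ≡ []
noCapacity⇒[] []                    _ = refl
noCapacity⇒[] {G = b ∷ G} (cap>0 ∷ _) none =
  ⊥-elim (occ-seats≢0 (colour b) cap>0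
           (trans (sym (capOf-extract (colour b) [] b G)) (none (colour b))))

noSeats⇒empty : ∀ {S : Vec (Spot c) n} → (∀ i → WellFormed (lookup S i)) →
                (∀ y → seats y S ≡ 0) → S ≡ replicate n ε
noSeats⇒empty {S = []}          _  _    = refl
noSeats⇒empty {S = ε ∷ S}       wf none =
  cong (ε ∷_) (noSeats⇒empty (wf ∘ suc) none)
noSeats⇒empty {S = occ y k ∷ S} wf none =
  ⊥-elim (occ-seats≢0 y (wf zero) (none y))

initial : ∀ {G : List (Bus c)} {Q} → All (λ b → 0 < cap b) G →
          Eligible ⟨ G , Q , replicate n ε ⟩ → Invariant G Q (replicate n ε)
initial {n = n} {G = G} caps eligible = record
  { caps-positive    = caps
  ; spots-wellFormed = λ i → subst WellFormed (sym (lookup-replicate i ε)) tt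
  ; oneSpotPerColour = λ y i _ p _ →
      contradiction (subst (λ w → 0 < seat y w) (lookup-replicate i ε) p) n≮0
  ; balanced         = λ y → trans (cong (capOf y G +_) (seats-replicate-ε n))
                                   (trans (+-identityʳ _) (eligible y))
  }

board-parked : ∀ {S : Vec (Spot c) n} → Invariant G (x ∷ Q) S → Parked x S →
               ∃ λ S′ → Step₂ ⟨ G , x ∷ Q , S ⟩ ⟨ G , Q , S′ ⟩ × Invariant G Q S′
board-parked {S = S} inv (i , p) with seated-occupant (lookup S i) p
... | k , e = _ , boarding S e , board-invariant inv e

unparked⇒capOf-positive : ∀ {S : Vec (Spot c) n} → Invariant G (x ∷ Q) S → ¬ Parked x S →
                          0 < capOf x G
unparked⇒capOf-positive {G = G} {x = x} {Q = Q} {S = S} inv ¬p =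
  subst (0 <_) (sym capOf≡) (s≤s z≤n)
  where
  capOf≡ : capOf x G ≡ suc (count x Q)
  capOf≡ = begin
    capOf x G              ≡⟨ +-identityʳ _ ⟨
    capOf x G + 0          ≡⟨ cong (capOf x G +_) (unparked⇒seats≡0 S ¬p) ⟨
    capOf x G + seats x S  ≡⟨ Invariant.balanced inv x ⟩
    count x (x ∷ Q)        ≡⟨ count-head x Q ⟩
    suc (count x Q)        ∎

park : ∀ {S : Vec (Spot c) n} → c ≤ n → Invariant G (x ∷ Q) S → ¬ Parked x S →
       ∃₂ λ G′ S′ → Step ⟨ G , x ∷ Q , S ⟩ ⟨ G′ , x ∷ Q , S′ ⟩ ×
                    Invariant G′ (x ∷ Q) S′ × Parked x S′
park {G = G} {x = x} {S = S} c≤n inv ¬p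
  with capOf-positive⇒split {x = x} {G = G} (unparked⇒capOf-positive inv ¬p)
     | emptySpot {S = S} c≤n (Invariant.spots-wellFormed inv)
                 (Invariant.oneSpotPerColour inv) ¬p
... | G₁ , G₂ , b , refl , refl | i , i-empty =
  G₁ ++ G₂ , S [ i ]≔ occ (colour b) (cap b) ,
  step₁ b i (cannot-board ¬p) i-empty ,
  park-invariant inv ¬p i-empty ,
  i , subst (λ w → 0 < seat (colour b) w) (sym (lookup∘update i S _)) (occ-seated cap>0)
  where
  cap>0 : 0 < cap b
  cap>0 = proj₁ (All-++-∷⁻ G₁ (Invariant.caps-positive inv))

serve : ∀ {S : Vec (Spot c) n} → c ≤ n → Invariant G (x ∷ Q) S →
        ∃₂ λ G′ S′ → Star Step ⟨ G , x ∷ Q , S ⟩ ⟨ G′ , Q , S′ ⟩ × Invariant G′ Q S′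
serve {x = x} {S = S} c≤n inv with parked? x S
... | yes p =
  let S′ , boarded , inv′ = board-parked inv p
  in  _ , S′ , step₂ boarded ◅ done , inv′
... | no ¬p =
  let G′ , S′ , parked , inv′ , p = park c≤n inv ¬p
      S″ , boarded , inv″ = board-parked inv′ p
  in  G′ , S″ , parked ◅ step₂ boarded ◅ done , inv″

solve : ∀ {S : Vec (Spot c) n} → c ≤ n → Invariant G Q S → Solvable ⟨ G , Q , S ⟩
solve {G = G} {Q = []} {S = S} _ inv
  with noCapacity⇒[] {G = G} caps-positive (λ y → m+n≡0⇒m≡0 _ (balanced y))
     | noSeats⇒empty {S = S} spots-wellFormed (λ y → m+n≡0⇒n≡0 _ (balanced y))
  where open Invariant inv
... | refl | refl = done
solve {Q = x ∷ Q} c≤n inv =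
  let _ , _ , steps , inv′ = serve c≤n inv
  in  steps ◅◅ solve c≤n inv′

theorem7 : (s c : ℕ) → 1 ≤ c → c ≤ s →
           (G : List (Bus c)) (Q : List (Fin c)) →
           All (λ b → 1 ≤ cap b) G →
           Eligible {c} {s} ⟨ G , Q , replicate s ε ⟩ →
           Solvable {c} {s} ⟨ G , Q , replicate s ε ⟩
theorem7 s c _ c≤s G Q caps eligible = solve c≤s (initial caps eligible)
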